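{- Suppose $\hat N\neq\hat N'$ are distinct crystals in an interchange graph ${\rm IntGr}(C_n,\mathbf s)$, $\mathbf s\in{\rm Score}(C_n)$. Then $\hat N,\hat N'$ are either edge-disjoint or share a double edge; in particular, no two such distinct crystals share a single edge.
   Context: Vectors: $\mathbf e^{\pm}_{ij}=\mathbf e_i\pm\mathbf e_j$ ($i>j$), $\mathbf e^\ell_i=2\mathbf e_i$ for negative edges $e^-_{ij}$, positive edges $e^+_{ij}$, loops $e^\ell_i$. $\mathcal K_{C_n}$ is the signed graph on $[n]$ with all negative and positive edges (one of each per pair) and all loops. A Coxeter tournament on $\mathcal K_{C_n}$ is $(w_e)$, $w_e\in\{0,1\}$, over its edges (games); score $\sum_e(w_e-\frac12)\mathbf e$; a sub-tournament is neutral if this sum over its games is $\mathbf 0$; $\mathcal T*\mathcal X$ flips outcomes of the games of $\mathcal X$. ${\rm Score}(C_n)$ = set of score sequences of tournaments on $\mathcal K_{C_n}$. A copy of a type-$C_n$ generator is a neutral sub-tournament whose games are either (neutral triangle) three negative edges pairwise joining three distinct vertices, or one negative and two positive edges pairwise joining three distinct vertices, or (neutral clover) $e^-_{ij},e^+_{ij},e^\ell_i$. ${\rm IntGr}(C_n,\mathbf s)$: multigraph on tournaments on $\mathcal K_{C_n}$ with score $\mathbf s$, $\mathcal T_1,\mathcal T_2$ joined iff $\mathcal T_2=\mathcal T_1*\mathcal G$ for a generator copy $\mathcal G\subseteq\mathcal T_1$ (double edge if clover, single otherwise). For $\mathcal T_1,\mathcal T_2$ at distance two, $N(\mathcal T_1,\mathcal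 T_2)$ is the union of all paths of length two between them, and the extended interchange network $\hat N(\mathcal T_1,\mathcal T_2)$ is the union of $N(\mathcal T_1',\mathcal T_2')$ over all pairs of vertices of $N(\mathcal T_1,\mathcal T_2)$ at distance two. A crystal is an extended interchange network isomorphic to the multigraph on six distinct vertices $a,b,c,d,y,z$ with single edges $ab,bc,cd,da$ and double edges $ay,cy,bz,dz$ (and no other edges). -}

module Defs where

open import Data.Bool using (Bool; true; false; not; if_then_else_)
open import Data.Nat using (ℕ)
open import Data.Integer using (ℤ; +_; -_; _+_; _-_; _*_)
open import Data.Fin using (Fin; Fin′; toℕ; inject; _≟_)
open import Data.Fin.Patterns using (0F; 1F; 2F; 3F; 4F; 5F)
open import Data.List using (List; []; _∷_; _++_; map; concatMap; allFin; foldr)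
open import Data.List.Membership.Propositional using (_∈_; _∉_)
open import Data.Product using (Σ; ∃; ∃-syntax; _×_; _,_)
open import Data.Sum using (_⊎_)
open import Data.Empty using (⊥)
open import Relation.Nullary using (¬_; does)
open import Relation.Binary.PropositionalEquality using (_≡_; _≢_)

-- Edges (= games):
--   neg i j : negative edge e^-_{ij}, vector e_i - e_j   (j < i)
--   pos i j : positive edge e^+_{ij}, vector e_i + e_j   (j < i)
--   loop i  : loop e^ℓ_i,            vector 2 e_i
-- The condition j < i is encoded by j : Fin′ i = Fin (toℕ i),
-- embedded in Fin n via 'inject'.  This gives exactly one negative and
-- one positive edge per unordered pair, and one loop per vertex.

data Edge (n : ℕ) : Set where
  neg  : (i : Fin n) → Fin′ i → Edge n
  pos  : (i : Fin n) → Fin′ i → Edge n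
  loop : Fin n → Edge n

allEdges : (n : ℕ) → List (Edge n)
allEdges n = concatMap (λ i → map (neg i) (allFin (toℕ i))
                              ++ map (pos i) (allFin (toℕ i))
                              ++ (loop i ∷ [])) (allFin n)

δ : {n : ℕ} → Fin n → Fin n → ℤ
δ i k = if does (i ≟ k) then + 1 else + 0

vec : {n : ℕ} → Edge n → Fin n → ℤ
vec (neg i j) k = δ i k - δ (inject j) k
vec (pos i j) k = δ i k + δ (inject j) k
vec (loop i)  k = + 2 * δ i k

-- Coxeter tournaments: an outcome w_e ∈ {0,1} (false/true) per game.

Tournament : ℕ → Set
Tournament n = Edge n → Bool

_≈_ : {n : ℕ} → Tournament n → Tournament n → Set
T ≈ U = ∀ e → T e ≡ U e

-- 2 (w_e - 1/2) ∈ {-1, +1}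
sgn : Bool → ℤ
sgn true  = + 1
sgn false = - (+ 1)

-- twice the score of the sub-tournament of T on the games in G:
--   2 · Σ_{e ∈ G} (w_e - 1/2) e     (coordinate k)
subScore2 : {n : ℕ} → Tournament n → List (Edge n) → Fin n → ℤ
subScore2 T G k = foldr _+_ (+ 0) (map (λ e → sgn (T e) * vec e k) G)

score2 : {n : ℕ} → Tournament n → Fin n → ℤ
score2 {n} T = subScore2 T (allEdges n)

Neutral : {n : ℕ} → Tournament n → List (Edge n) → Set
Neutral T G = ∀ k → subScore2 T G k ≡ + 0

-- s ∈ Score(C_n)  (s given doubled, as 2s, to stay in ℤ)
InScore : {n : ℕ} → (Fin n → ℤ) → Set
InScore {n} s = ∃[ T ] (∀ k → score2 {n} T k ≡ s k)

Vtx : {n : ℕ} → (Fin n → ℤ) → Tournament n → Set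
Vtx s T = ∀ k → score2 T k ≡ s k

IsFlip : {n : ℕ} → Tournament n → List (Edge n) → Tournament n → Set
IsFlip T₁ G T₂ = ∀ e → (e ∈ G → T₂ e ≡ not (T₁ e)) × (e ∉ G → T₂ e ≡ T₁ e)

JoinsNeg : {n : ℕ} → Edge n → Fin n → Fin n → Set
JoinsNeg (neg i j) a b = (i ≡ a × inject j ≡ b) ⊎ (i ≡ b × inject j ≡ a)
JoinsNeg (pos i j) a b = ⊥
JoinsNeg (loop i)  a b = ⊥

JoinsPos : {n : ℕ} → Edge n → Fin n → Fin n → Set
JoinsPos (neg i j) a b = ⊥
JoinsPos (pos i j) a b = (i ≡ a × inject j ≡ b) ⊎ (i ≡ b × inject j ≡ a)
JoinsPos (loop i)  a b = ⊥

LoopAt : {n : ℕ} → Edge n → Fin n → Set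
LoopAt (neg i j) a = ⊥
LoopAt (pos i j) a = ⊥
LoopAt (loop i)  a = i ≡ a

Distinct3 : {n : ℕ} → Fin n → Fin n → Fin n → Set
Distinct3 a b c = a ≢ b × b ≢ c × a ≢ c

TriangleNNN : {n : ℕ} → List (Edge n) → Set
TriangleNNN {n} G = ∃[ a ] ∃[ b ] ∃[ c ] ∃[ e₁ ] ∃[ e₂ ] ∃[ e₃ ]
  (Distinct3 {n} a b c × G ≡ e₁ ∷ e₂ ∷ e₃ ∷ []
   × JoinsNeg e₁ a b × JoinsNeg e₂ b c × JoinsNeg e₃ a c)

TriangleNPP : {n : ℕ} → List (Edge n) → Set
TriangleNPP {n} G = ∃[ a ] ∃[ b ] ∃[ c ] ∃[ e₁ ] ∃[ e₂ ] ∃[ e₃ ]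
  (Distinct3 {n} a b c × G ≡ e₁ ∷ e₂ ∷ e₃ ∷ []
   × JoinsNeg e₁ a b × JoinsPos e₂ b c × JoinsPos e₃ a c)

Clover : {n : ℕ} → List (Edge n) → Set
Clover {n} G = ∃[ a ] ∃[ b ] ∃[ e₁ ] ∃[ e₂ ] ∃[ e₃ ]
  (a ≢ b × G ≡ e₁ ∷ e₂ ∷ e₃ ∷ []
   × JoinsNeg {n} e₁ a b × JoinsPos e₂ a b × LoopAt e₃ a)

-- Adjacency does not depend on s
-- (flipping a neutral sub-tournament preserves the score), so IntGr(C_n,s)
-- is the restriction of the following multigraph to Vtx s.

AdjS : {n : ℕ} → Tournament n → Tournament n → Set
AdjS {n} T₁ T₂ = ∃[ G ] ((TriangleNNN {n} G ⊎ TriangleNPP G)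
                         × Neutral T₁ G × IsFlip T₁ G T₂)

AdjD : {n : ℕ} → Tournament n → Tournament n → Set
AdjD {n} T₁ T₂ = ∃[ G ] (Clover {n} G × Neutral T₁ G × IsFlip T₁ G T₂)

Adj : {n : ℕ} → Tournament n → Tournament n → Set
Adj T U = AdjS T U ⊎ AdjD T U

MultIs : {n : ℕ} → Tournament n → Tournament n → ℕ → Set
MultIs T U m = (m ≡ 0 × ¬ Adj T U) ⊎ (m ≡ 1 × AdjS T U) ⊎ (m ≡ 2 × AdjD T U)

Dist2 : {n : ℕ} → Tournament n → Tournament n → Set
Dist2 T U = ¬ (T ≈ U) × ¬ Adj T U × ∃[ M ] (Adj T M × Adj M U)

InN : {n : ℕ} → Tournament n → Tournament n → Tournament n → Set
InN T₁ T₂ X = X ≈ T₁ ⊎ X ≈ T₂ ⊎ (Adj T₁ X × Adj X T₂)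

EdgeN : {n : ℕ} → Tournament n → Tournament n → Tournament n → Tournament n → Set
EdgeN T₁ T₂ X Y =
  Adj X Y × (((X ≈ T₁ ⊎ X ≈ T₂) × (Adj T₁ Y × Adj Y T₂))
            ⊎ ((Y ≈ T₁ ⊎ Y ≈ T₂) × (Adj T₁ X × Adj X T₂)))

InNhat : {n : ℕ} → Tournament n → Tournament n → Tournament n → Set
InNhat T₁ T₂ X = ∃[ U₁ ] ∃[ U₂ ]
  (InN T₁ T₂ U₁ × InN T₁ T₂ U₂ × Dist2 U₁ U₂ × InN U₁ U₂ X)

EdgeNhat : {n : ℕ} → Tournament n → Tournament n → Tournament n → Tournament n → Set
EdgeNhat T₁ T₂ X Y = ∃[ U₁ ] ∃[ U₂ ]
  (InN T₁ T₂ U₁ × InN T₁ T₂ U₂ × Dist2 U₁ U₂ × EdgeN U₁ U₂ X Y)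

NhatMult : {n : ℕ} → Tournament n → Tournament n → Tournament n → Tournament n → ℕ → Set
NhatMult T₁ T₂ X Y m = (EdgeNhat T₁ T₂ X Y × MultIs X Y m)
                     ⊎ (¬ EdgeNhat T₁ T₂ X Y × m ≡ 0)

-- The crystal model multigraph on a=0, b=1, c=2, d=3, y=4, z=5:
-- single edges ab, bc, cd, da; double edges ay, cy, bz, dz.

crystalMult : Fin 6 → Fin 6 → ℕ
crystalMult 0F 1F = 1
crystalMult 1F 0F = 1
crystalMult 1F 2F = 1
crystalMult 2F 1F = 1
crystalMult 2F 3F = 1
crystalMult 3F 2F = 1
crystalMult 3F 0F = 1
crystalMult 0F 3F = 1
crystalMult 0F 4F = 2
crystalMult 4F 0F = 2
crystalMult 2F 4F = 2
crystalMult 4F 2F = 2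
crystalMult 1F 5F = 2
crystalMult 5F 1F = 2
crystalMult 3F 5F = 2
crystalMult 5F 3F = 2
crystalMult _  _  = 0

IsCrystal : {n : ℕ} → Tournament n → Tournament n → Set
IsCrystal {n} T₁ T₂ = Dist2 T₁ T₂ × Σ (Fin 6 → Tournament n) λ φ →
    (∀ k l → φ k ≈ φ l → k ≡ l)
  × (∀ k → InNhat T₁ T₂ (φ k))
  × (∀ X → InNhat T₁ T₂ X → ∃[ k ] (X ≈ φ k))
  × (∀ k l → NhatMult T₁ T₂ (φ k) (φ l) (crystalMult k l))

SameNhat : {n : ℕ} → Tournament n → Tournament n → Tournament n → Tournament n → Set
SameNhat T₁ T₂ U₁ U₂ =
    (∀ X → (InNhat T₁ T₂ X → InNhat U₁ U₂ X) × (InNhat U₁ U₂ X → InNhat T₁ T₂ X))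
  × (∀ X Y → (EdgeNhat T₁ T₂ X Y → EdgeNhat U₁ U₂ X Y)
           × (EdgeNhat U₁ U₂ X Y → EdgeNhat T₁ T₂ X Y))

-- In a crystal every single edge a–b lies in a square: single edges a–b–c and double edges
-- a–y–c. The clovers flipped along a → y → c share their loop vertex p, since triangles never
-- flip loops, and have distinct second vertices q, q′, since otherwise c = a. Both edges of the
-- pairs {p,q} and {p,q′} differ between a and c, and no triangle contains both edges of a pair,
-- so the triangle flipped along a → b is the triangle on p, q, q′. Neutrality of the clovers
-- pins down the roles of these three vertices: at p the negative and the positive edge of each
-- clover contribute with equal signs, which cannot happen at both ends of a pair, and the loop
-- at p opposes the edges towards q but follows those towards q′. Hence a and b determine c and
-- y; walking around the model from one single edge recovers all six vertices, so distinct
-- crystals share no single edge, and every shared edge is double.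

{-# OPTIONS --safe #-}
module Submission where

open import Defs
open import Data.Bool using (true; false; not)
import Data.Bool.Properties as Bool
open import Data.Nat as ℕ using (ℕ)
import Data.Nat.Properties as ℕ
open import Data.Integer using (ℤ; +_; -_; _*_; _+_)
import Data.Integer.Properties as ℤ
open import Data.Fin using (Fin; Fin′; toℕ; inject; _≟_)
import Data.Fin.Properties as Fin
open import Data.Fin.Patterns using (0F; 1F; 2F; 3F; 4F; 5F)
open import Data.List using (List; []; _∷_; foldr; lookup)
import Data.List.Properties as List
open import Data.List.Membership.Propositional using (_∈_; _∉_)
open import Data.List.Relation.Unary.Any as Any using (here; there)
open import Data.List.Relation.Unary.Any.Properties using (lookup-index)
open import Data.Product using (Σ; ∃-syntax; _×_; _,_; proj₁; proj₂; uncurry)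
import Data.Product.Properties as Product
open import Data.Sum as Sum using (_⊎_; inj₁; inj₂)
import Data.Sum.Properties as Sum
open import Data.Empty using (⊥; ⊥-elim)
open import Function using (_∘_; _∋_)
open import Relation.Nullary using (¬_; Dec; yes; no)
open import Relation.Nullary.Decidable
  using (map′; toWitness; dec-true; dec-false; ¬?; _×-dec_; _⊎-dec_; _→-dec_)
open import Relation.Binary.Definitions using (DecidableEquality)
open import Relation.Binary.PropositionalEquality

private variable
  n : ℕ
  p p′ q q′ r s s′ u v w : Fin n
  e eN eP : Edge n
  G : List (Edge n)
  T T′ U U′ T₁ T₂ U₁ U₂ a a′ b b′ c c′ y y′ : Tournament n
  φ ψ : Fin 6 → Tournament n
  σ : Fin 6 → Fin 6
  m : ℕ

inject-injective : {i : Fin n} {j k : Fin′ i} → inject j ≡ inject k → j ≡ k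
inject-injective {j = j} {k = k} eq =
  Fin.toℕ-injective (trans (sym (Fin.toℕ-inject j)) (trans (cong toℕ eq) (Fin.toℕ-inject k)))

toℕ-inject< : {i : Fin n} (j : Fin′ i) → toℕ (inject j) ℕ.< toℕ i
toℕ-inject< {i = i} j = subst (ℕ._< toℕ i) (sym (Fin.toℕ-inject j)) (Fin.toℕ<n j)

inject≢ : {i : Fin n} (j : Fin′ i) → inject j ≢ i
inject≢ j eq = ℕ.<-irrefl (cong toℕ eq) (toℕ-inject< j)

-- JoinsNeg (neg i j) and JoinsPos (pos i j) unfold to SamePair i (inject j).
SamePair : Fin n → Fin n → Fin n → Fin n → Set
SamePair p q u v = (p ≡ u × q ≡ v) ⊎ (p ≡ v × q ≡ u)

samePair-sym : SamePair p q u v → SamePair u v p q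
samePair-sym (inj₁ (refl , refl)) = inj₁ (refl , refl)
samePair-sym (inj₂ (refl , refl)) = inj₂ (refl , refl)

samePair-trans : SamePair p q u v → SamePair u v r s → SamePair p q r s
samePair-trans (inj₁ (refl , refl)) h = h
samePair-trans (inj₂ (refl , refl)) (inj₁ (refl , refl)) = inj₂ (refl , refl)
samePair-trans (inj₂ (refl , refl)) (inj₂ (refl , refl)) = inj₁ (refl , refl)

samePair-swap : SamePair p q u v → SamePair p q v u
samePair-swap = Sum.swap

samePair-≢ : u ≢ v → SamePair u v p q → p ≢ q
samePair-≢ u≢v (inj₁ (refl , refl)) = u≢v
samePair-≢ u≢v (inj₂ (refl , refl)) = u≢v ∘ sym

endpoints-unique : {i i′ : Fin n} {j : Fin′ i} {j′ : Fin′ i′} →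
  SamePair i (inject j) i′ (inject j′) → (Σ (Fin n) Fin′ ∋ (i , j)) ≡ (i′ , j′)
endpoints-unique (inj₁ (refl , eq)) = cong (_ ,_) (inject-injective eq)
endpoints-unique {j = j} {j′ = j′} (inj₂ (i≡ , ≡i′)) = ⊥-elim (ℕ.<-asym
  (subst (toℕ (inject j) ℕ.<_) (cong toℕ i≡) (toℕ-inject< j))
  (subst (toℕ (inject j′) ℕ.<_) (cong toℕ (sym ≡i′)) (toℕ-inject< j′)))

Joins : Edge n → Fin n → Fin n → Set
Joins e p q = JoinsNeg e p q ⊎ JoinsPos e p q

joinsNeg-unique : {e e′ : Edge n} → JoinsNeg e p q → JoinsNeg e′ p q → e ≡ e′
joinsNeg-unique {e = neg _ _} {neg _ _} h h′ =
  cong (uncurry neg) (endpoints-unique (samePair-trans h (samePair-sym h′)))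
joinsNeg-unique {e = neg _ _} {pos _ _} _ ()
joinsNeg-unique {e = neg _ _} {loop _} _ ()
joinsNeg-unique {e = pos _ _} ()
joinsNeg-unique {e = loop _} ()

joinsPos-unique : {e e′ : Edge n} → JoinsPos e p q → JoinsPos e′ p q → e ≡ e′
joinsPos-unique {e = pos _ _} {pos _ _} h h′ =
  cong (uncurry pos) (endpoints-unique (samePair-trans h (samePair-sym h′)))
joinsPos-unique {e = pos _ _} {neg _ _} _ ()
joinsPos-unique {e = pos _ _} {loop _} _ ()
joinsPos-unique {e = neg _ _} ()
joinsPos-unique {e = loop _} ()

joinsNeg-swap : JoinsNeg e p q → JoinsNeg e q p
joinsNeg-swap {e = neg _ _} = samePair-swap

joinsPos-swap : JoinsPos e p q → JoinsPos e q p
joinsPos-swap {e = pos _ _} = samePair-swap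

joinsNeg-≢ : JoinsNeg e p q → p ≢ q
joinsNeg-≢ {e = neg i j} = samePair-≢ (inject≢ j ∘ sym)

joins-≢ : Joins e p q → p ≢ q
joins-≢ {e = neg i j} (inj₁ h) = samePair-≢ (inject≢ j ∘ sym) h
joins-≢ {e = pos i j} (inj₂ h) = samePair-≢ (inject≢ j ∘ sym) h

joins-samePair : Joins e p q → Joins e u v → SamePair p q u v
joins-samePair {e = neg _ _} (inj₁ h) (inj₁ h′) = samePair-trans (samePair-sym h) h′
joins-samePair {e = pos _ _} (inj₂ h) (inj₂ h′) = samePair-trans (samePair-sym h) h′
joins-samePair {e = neg _ _} (inj₁ _) (inj₂ ())
joins-samePair {e = pos _ _} (inj₂ _) (inj₁ ())
joins-samePair {e = neg _ _} (inj₂ ()) _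
joins-samePair {e = pos _ _} (inj₁ ()) _
joins-samePair {e = loop _} (inj₁ ()) _
joins-samePair {e = loop _} (inj₂ ()) _

joins-other-end : Joins e p q → Joins e p q′ → q ≡ q′
joins-other-end j j′ with joins-samePair j j′
... | inj₁ (_ , q≡q′) = q≡q′
... | inj₂ (_ , q≡p) = ⊥-elim (joins-≢ j (sym q≡p))

joinsNeg-joinsPos-exclusive : JoinsNeg e p q → JoinsPos e u v → ⊥
joinsNeg-joinsPos-exclusive {e = neg _ _} _ ()

private
  EdgeCode : ℕ → Set
  EdgeCode n = (Σ (Fin n) Fin′ ⊎ Σ (Fin n) Fin′) ⊎ Fin n

  encode : Edge n → EdgeCode n
  encode (neg i j) = inj₁ (inj₁ (i , j))
  encode (pos i j) = inj₁ (inj₂ (i , j))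
  encode (loop i)  = inj₂ i

  decode : EdgeCode n → Edge n
  decode (inj₁ (inj₁ (i , j))) = neg i j
  decode (inj₁ (inj₂ (i , j))) = pos i j
  decode (inj₂ i)              = loop i

  decode-encode : (e : Edge n) → decode (encode e) ≡ e
  decode-encode (neg _ _) = refl
  decode-encode (pos _ _) = refl
  decode-encode (loop _)  = refl

_≟ₑ_ : DecidableEquality (Edge n)
e ≟ₑ e′ = map′ (λ eq → trans (sym (decode-encode e)) (trans (cong decode eq) (decode-encode e′)))
               (cong encode) (code? (encode e) (encode e′))
  where
  pair? : DecidableEquality (Σ (Fin n) Fin′)
  pair? = Product.≡-dec _≟_ _≟_
  code? : DecidableEquality (EdgeCode n)
  code? = Sum.≡-dec (Sum.≡-dec pair? pair?) _≟_

_∈?_ : (e : Edge n) (G : List (Edge n)) → Dec (e ∈ G)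
e ∈? G = Any.any? (e ≟ₑ_) G

δ-refl : (x : Fin n) → δ x x ≡ + 1
δ-refl x rewrite dec-true (x ≟ x) refl = refl

δ-≢ : {x y : Fin n} → x ≢ y → δ x y ≡ + 0
δ-≢ {x = x} {y = y} x≢y rewrite dec-false (x ≟ y) x≢y = refl

vec-joinsNeg : JoinsNeg e p q → ∃[ o ] (vec e p ≡ sgn o × vec e q ≡ sgn (not o))
vec-joinsNeg {e = neg i j} (inj₁ (refl , refl))
  rewrite δ-refl i | δ-refl (inject j) | δ-≢ (inject≢ j) | δ-≢ (inject≢ j ∘ sym) = true , refl , refl
vec-joinsNeg {e = neg i j} (inj₂ (refl , refl))
  rewrite δ-refl i | δ-refl (inject j) | δ-≢ (inject≢ j) | δ-≢ (inject≢ j ∘ sym) = false , refl , refl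

vec-joinsPos : JoinsPos e p q → vec e p ≡ + 1 × vec e q ≡ + 1
vec-joinsPos {e = pos i j} (inj₁ (refl , refl))
  rewrite δ-refl i | δ-refl (inject j) | δ-≢ (inject≢ j) | δ-≢ (inject≢ j ∘ sym) = refl , refl
vec-joinsPos {e = pos i j} (inj₂ (refl , refl))
  rewrite δ-refl i | δ-refl (inject j) | δ-≢ (inject≢ j) | δ-≢ (inject≢ j ∘ sym) = refl , refl

vec-loop : (p : Fin n) → vec (loop p) p ≡ + 2
vec-loop p rewrite δ-refl p = refl

vec-loop-≢ : p ≢ q → vec (loop p) q ≡ + 0
vec-loop-≢ p≢q rewrite δ-≢ p≢q = refl

contrib : Tournament n → Edge n → Fin n → ℤ
contrib T e v = sgn (T e) * vec e v

sgn-not : ∀ b → sgn (not b) ≡ - sgn b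
sgn-not true  = refl
sgn-not false = refl

private
  -- Neutrality of a clover at its two vertices, with the edge vectors evaluated.
  clover-signs : ∀ o x y z →
    sgn x * sgn (not o) + (sgn y * + 1 + (sgn z * + 0 + + 0)) ≡ + 0 →
    sgn x * sgn o + (sgn y * + 1 + (sgn z * + 2 + + 0)) ≡ + 0 →
    sgn x * sgn o ≡ sgn y * + 1 × sgn z ≡ - (sgn x * sgn o)
  clover-signs true  true  true  false _ _ = refl , refl
  clover-signs true  false false true  _ _ = refl , refl
  clover-signs false true  false true  _ _ = refl , refl
  clover-signs false false true  false _ _ = refl , refl
  clover-signs true  true  true  true  _  ()
  clover-signs true  true  false true  () _
  clover-signs true  true  false false () _
  clover-signs true  false true  true  () _
  clover-signs true  false true  false () _
  clover-signs true  false false false _  ()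
  clover-signs false true  true  true  () _
  clover-signs false true  true  false () _
  clover-signs false true  false false _  ()
  clover-signs false false true  true  _  ()
  clover-signs false false false true  () _
  clover-signs false false false false () _

  opposite-signs : ∀ o x y → sgn x * sgn o ≡ sgn y * + 1 → sgn x * sgn (not o) ≡ sgn y * + 1 → ⊥
  opposite-signs true  true  true  _  ()
  opposite-signs true  true  false () _
  opposite-signs true  false true  () _
  opposite-signs true  false false _  ()
  opposite-signs false true  true  () _
  opposite-signs false true  false _  ()
  opposite-signs false false true  _  ()
  opposite-signs false false false () _

  sgn*sgn≢neg : ∀ x o → sgn x * sgn o ≢ - (sgn x * sgn o)
  sgn*sgn≢neg true  true  ()
  sgn*sgn≢neg true  false ()
  sgn*sgn≢neg false true  ()
  sgn*sgn≢neg false false ()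

contrib-joinsNeg-≢-neg : JoinsNeg e p q → contrib T e p ≢ - contrib T e p
contrib-joinsNeg-≢-neg {e = e} {T = T} j with vec-joinsNeg j
... | o , vp , _ rewrite vp = sgn*sgn≢neg (T e) o

flip-∈ : IsFlip T G U → e ∈ G → U e ≡ not (T e)
flip-∈ F e∈G = proj₁ (F _) e∈G

flip-∉ : IsFlip T G U → e ∉ G → U e ≡ T e
flip-∉ F e∉G = proj₂ (F _) e∉G

flip-changed : IsFlip T G U → T e ≢ U e → e ∈ G
flip-changed {G = G} {e = e} F Te≢Ue with e ∈? G
... | yes e∈G = e∈G
... | no e∉G = ⊥-elim (Te≢Ue (sym (flip-∉ F e∉G)))

flip-unique : {G G′ : List (Edge n)} → G ≡ G′ → T ≈ T′ → IsFlip T G U → IsFlip T′ G′ U′ → U ≈ U′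
flip-unique {G = G} refl T≈T′ F F′ e with e ∈? G
... | yes e∈G = trans (flip-∈ F e∈G) (trans (cong not (T≈T′ e)) (sym (flip-∈ F′ e∈G)))
... | no e∉G = trans (flip-∉ F e∉G) (trans (T≈T′ e) (sym (flip-∉ F′ e∉G)))

flip-involutive : IsFlip T G U → IsFlip U G U′ → T ≈ U′
flip-involutive {G = G} F F′ e with e ∈? G
... | yes e∈G = sym (trans (flip-∈ F′ e∈G) (trans (cong not (flip-∈ F e∈G)) (Bool.not-involutive _)))
... | no e∉G = sym (trans (flip-∉ F′ e∉G) (flip-∉ F e∉G))

Triangle : List (Edge n) → Set
Triangle G = TriangleNNN G ⊎ TriangleNPP G

samePair-∈ : {V : List (Fin n)} → SamePair p q u v → u ∈ V → v ∈ V → p ∈ V × q ∈ V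
samePair-∈ (inj₁ (refl , refl)) u∈V v∈V = u∈V , v∈V
samePair-∈ (inj₂ (refl , refl)) u∈V v∈V = v∈V , u∈V

triangle-games : Triangle G → ∃[ a ] ∃[ b ] ∃[ c ] (∀ {e} → e ∈ G →
  ∃[ u ] ∃[ v ] (Joins e u v × u ∈ a ∷ b ∷ c ∷ [] × v ∈ a ∷ b ∷ c ∷ []))
triangle-games (inj₁ (a , b , c , _ , _ , _ , _ , refl , j₁ , j₂ , j₃)) = a , b , c , λ where
  (here refl)                 → a , b , inj₁ j₁ , here refl , there (here refl)
  (there (here refl))         → b , c , inj₁ j₂ , there (here refl) , there (there (here refl))
  (there (there (here refl))) → a , c , inj₁ j₃ , here refl , there (there (here refl))
triangle-games (inj₂ (a , b , c , _ , _ , _ , _ , refl , j₁ , j₂ , j₃)) = a , b , c , λ where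
  (here refl)                 → a , b , inj₁ j₁ , here refl , there (here refl)
  (there (here refl))         → b , c , inj₂ j₂ , there (here refl) , there (there (here refl))
  (there (there (here refl))) → a , c , inj₂ j₃ , here refl , there (there (here refl))

triangle-loop-free : Triangle G → loop v ∉ G
triangle-loop-free t loop∈G with triangle-games t
... | _ , _ , _ , games with games loop∈G
... | _ , _ , inj₁ () , _
... | _ , _ , inj₂ () , _

triangle-support : Triangle G → ∃[ a ] ∃[ b ] ∃[ c ]
  (∀ {e p q} → e ∈ G → Joins e p q → p ∈ a ∷ b ∷ c ∷ [] × q ∈ a ∷ b ∷ c ∷ [])
triangle-support t with triangle-games t
... | a , b , c , games = a , b , c , λ e∈G j →
  let (_ , _ , j′ , u∈ , v∈) = games e∈G in samePair-∈ (joins-samePair j j′) u∈ v∈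

triangle-pair-free : Triangle G → eN ∈ G → eP ∈ G → JoinsNeg eN p q → JoinsPos eP p q → ⊥
triangle-pair-free (inj₁ (_ , _ , _ , _ , _ , _ , _ , refl , j₁ , j₂ , j₃)) _ eP∈G _ P with eP∈G
... | here refl                 = joinsNeg-joinsPos-exclusive j₁ P
... | there (here refl)         = joinsNeg-joinsPos-exclusive j₂ P
... | there (there (here refl)) = joinsNeg-joinsPos-exclusive j₃ P
triangle-pair-free (inj₂ (_ , _ , _ , _ , _ , _ , (a≢b , b≢c , a≢c) , refl , j₁ , j₂ , j₃)) eN∈G eP∈G N P
  with eN∈G | eP∈G
... | there (here refl)         | _                         = joinsNeg-joinsPos-exclusive N j₂
... | there (there (here refl)) | _                         = joinsNeg-joinsPos-exclusive N j₃
... | here refl                 | here refl                 = joinsNeg-joinsPos-exclusive j₁ P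
... | here refl                 | there (here refl)         = Sum.[ a≢b ∘ proj₁ , a≢c ∘ proj₁ ]
  (samePair-trans (joins-samePair (inj₁ j₁) (inj₁ N)) (joins-samePair (inj₂ P) (inj₂ j₂)))
... | here refl                 | there (there (here refl)) = Sum.[ b≢c ∘ proj₂ , a≢c ∘ proj₁ ]
  (samePair-trans (joins-samePair (inj₁ j₁) (inj₁ N)) (joins-samePair (inj₂ P) (inj₂ j₃)))

record EdgePair {n} (p q : Fin n) : Set where
  constructor edgePair
  field
    {negE posE} : Edge n
    negJ : JoinsNeg negE p q
    posJ : JoinsPos posE p q
open EdgePair

clover : {p q : Fin n} → EdgePair p q → List (Edge n)
clover {p = p} P = negE P ∷ posE P ∷ loop p ∷ []

clover-unique : (P P′ : EdgePair p q) → clover P ≡ clover P′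
clover-unique {p = p} P P′ = cong₂ (λ eN eP → eN ∷ eP ∷ loop p ∷ [])
  (joinsNeg-unique (negJ P) (negJ P′)) (joinsPos-unique (posJ P) (posJ P′))

loop-∈-clover : (P : EdgePair p q) → loop p ∈ clover P
loop-∈-clover _ = there (there (here refl))

loop-∉-clover : v ≢ p → (P : EdgePair p q) → loop v ∉ clover P
loop-∉-clover _ (edgePair () _) (here refl)
loop-∉-clover _ (edgePair _ ()) (there (here refl))
loop-∉-clover v≢p _ (there (there (here refl))) = v≢p refl

joins-∉-clover : q ≢ q′ → Joins e p q → (P : EdgePair p q′) → e ∉ clover P
joins-∉-clover q≢q′ j (edgePair N _) (here refl)         = q≢q′ (joins-other-end j (inj₁ N))
joins-∉-clover q≢q′ j (edgePair _ P) (there (here refl)) = q≢q′ (joins-other-end j (inj₂ P))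
joins-∉-clover _ (inj₁ ()) _ (there (there (here refl)))
joins-∉-clover _ (inj₂ ()) _ (there (there (here refl)))

adjD-view : AdjD T U → ∃[ p ] ∃[ q ] Σ (EdgePair p q) λ P → Neutral T (clover P) × IsFlip T (clover P) U
adjD-view (_ , (p , q , _ , _ , loop _ , _ , refl , N , P , refl) , neutral , flip) =
  p , q , edgePair N P , neutral , flip
adjD-view (_ , (_ , _ , _ , _ , neg _ _ , _ , _ , _ , _ , ()) , _)
adjD-view (_ , (_ , _ , _ , _ , pos _ _ , _ , _ , _ , _ , ()) , _)

clover-neutral : (P : EdgePair p q) → Neutral T (clover P) →
  contrib T (negE P) p ≡ contrib T (posE P) p × sgn (T (loop p)) ≡ - contrib T (negE P) p
clover-neutral {p = p} {q = q} {T = T} P neutral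
  with vec-joinsNeg (negJ P) | vec-joinsPos (posJ P) | neutral q | neutral p
... | o , Np , Nq | Pp , Pq | at-q | at-p
  rewrite Np | Nq | Pp | Pq | vec-loop p | vec-loop-≢ (joinsNeg-≢ (negJ P)) =
  clover-signs o (T (negE P)) (T (posE P)) (T (loop p)) at-q at-p

Agrees : Tournament n → Fin n → Fin n → Set
Agrees T p q = Σ (EdgePair p q) λ P → contrib T (negE P) p ≡ contrib T (posE P) p

-- The negative edge contributes opposite signs at its two ends, the positive edge equal ones.
agrees-asym : Agrees T p q → Agrees T q p → ⊥
agrees-asym {T = T} {p = p} {q = q} (P , at-p) (P′ , at-q′) with
  subst₂ (λ eN eP → contrib T eN q ≡ contrib T eP q)
    (joinsNeg-unique (joinsNeg-swap (negJ P′)) (negJ P)) (joinsPos-unique (joinsPos-swap (posJ P′)) (posJ P)) at-q′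
... | at-q with vec-joinsNeg (negJ P) | vec-joinsPos (posJ P)
... | o , Np , Nq | Pp , Pq rewrite Np | Nq | Pp | Pq = opposite-signs o (T (negE P)) (T (posE P)) at-p at-q

≈-refl : T ≈ T
≈-refl _ = refl

≈-sym : T ≈ U → U ≈ T
≈-sym T≈U e = sym (T≈U e)

≈-trans : T ≈ U → U ≈ U′ → T ≈ U′
≈-trans T≈U U≈U′ e = trans (T≈U e) (U≈U′ e)

neutral-resp : T ≈ T′ → Neutral T G → Neutral T′ G
neutral-resp {G = G} T≈T′ neutral k = trans
  (cong (foldr _+_ (+ 0)) (List.map-cong (λ e → cong (λ b → sgn b * vec e k) (sym (T≈T′ e))) G))
  (neutral k)

isFlip-resp : T ≈ T′ → U ≈ U′ → IsFlip T G U → IsFlip T′ G U′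
isFlip-resp T≈T′ U≈U′ F e =
    (λ e∈G → trans (sym (U≈U′ e)) (trans (flip-∈ F e∈G) (cong not (T≈T′ e))))
  , (λ e∉G → trans (sym (U≈U′ e)) (trans (flip-∉ F e∉G) (T≈T′ e)))

step-resp : {Shape : List (Edge n) → Set} → T ≈ T′ → U ≈ U′ →
  ∃[ G ] (Shape G × Neutral T G × IsFlip T G U) → ∃[ G ] (Shape G × Neutral T′ G × IsFlip T′ G U′)
step-resp T≈T′ U≈U′ (G , shape , neutral , F) = G , shape , neutral-resp {G = G} T≈T′ neutral , isFlip-resp T≈T′ U≈U′ F

adjS-resp : T ≈ T′ → U ≈ U′ → AdjS T U → AdjS T′ U′
adjS-resp = step-resp

adjD-resp : T ≈ T′ → U ≈ U′ → AdjD T U → AdjD T′ U′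
adjD-resp = step-resp

adj-resp : T ≈ T′ → U ≈ U′ → Adj T U → Adj T′ U′
adj-resp T≈T′ U≈U′ = Sum.map (adjS-resp T≈T′ U≈U′) (adjD-resp T≈T′ U≈U′)

endpoint-resp : T ≈ T′ → T ≈ T₁ ⊎ T ≈ T₂ → T′ ≈ T₁ ⊎ T′ ≈ T₂
endpoint-resp T≈T′ = Sum.map (≈-trans (≈-sym T≈T′)) (≈-trans (≈-sym T≈T′))

inN-resp : T ≈ T′ → InN T₁ T₂ T → InN T₁ T₂ T′
inN-resp T≈T′ (inj₁ T≈T₁) = inj₁ (≈-trans (≈-sym T≈T′) T≈T₁)
inN-resp T≈T′ (inj₂ (inj₁ T≈T₂)) = inj₂ (inj₁ (≈-trans (≈-sym T≈T′) T≈T₂))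
inN-resp T≈T′ (inj₂ (inj₂ (T₁T , TT₂))) = inj₂ (inj₂ (adj-resp ≈-refl T≈T′ T₁T , adj-resp T≈T′ ≈-refl TT₂))

edgeN-resp : T ≈ T′ → U ≈ U′ → EdgeN T₁ T₂ T U → EdgeN T₁ T₂ T′ U′
edgeN-resp T≈T′ U≈U′ (TU , inj₁ (end , T₁U , UT₂)) = adj-resp T≈T′ U≈U′ TU ,
  inj₁ (endpoint-resp T≈T′ end , adj-resp ≈-refl U≈U′ T₁U , adj-resp U≈U′ ≈-refl UT₂)
edgeN-resp T≈T′ U≈U′ (TU , inj₂ (end , T₁T , TT₂)) = adj-resp T≈T′ U≈U′ TU ,
  inj₂ (endpoint-resp U≈U′ end , adj-resp ≈-refl T≈T′ T₁T , adj-resp T≈T′ ≈-refl TT₂)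

edgeN-inN : EdgeN T₁ T₂ T U → InN T₁ T₂ T × InN T₁ T₂ U
edgeN-inN (_ , inj₁ (end , T₁U , UT₂)) = Sum.map₂ inj₁ end , inj₂ (inj₂ (T₁U , UT₂))
edgeN-inN (_ , inj₂ (end , T₁T , TT₂)) = inj₂ (inj₂ (T₁T , TT₂)) , Sum.map₂ inj₁ end

inNhat-resp : T ≈ T′ → InNhat T₁ T₂ T → InNhat T₁ T₂ T′
inNhat-resp T≈T′ (V₁ , V₂ , in₁ , in₂ , d , inN) = V₁ , V₂ , in₁ , in₂ , d , inN-resp T≈T′ inN

edgeNhat-resp : T ≈ T′ → U ≈ U′ → EdgeNhat T₁ T₂ T U → EdgeNhat T₁ T₂ T′ U′
edgeNhat-resp T≈T′ U≈U′ (V₁ , V₂ , in₁ , in₂ , d , E) = V₁ , V₂ , in₁ , in₂ , d , edgeN-resp T≈T′ U≈U′ E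

edgeNhat-inNhat : EdgeNhat T₁ T₂ T U → InNhat T₁ T₂ T × InNhat T₁ T₂ U
edgeNhat-inNhat (V₁ , V₂ , in₁ , in₂ , d , E) =
  (V₁ , V₂ , in₁ , in₂ , d , proj₁ (edgeN-inN E)) , (V₁ , V₂ , in₁ , in₂ , d , proj₂ (edgeN-inN E))

edgeNhat-adj : EdgeNhat T₁ T₂ T U → Adj T U
edgeNhat-adj (_ , _ , _ , _ , _ , TU , _) = TU

-- Squares: single edges a–b–c and double edges a–y–c

Square : Tournament n → Tournament n → Tournament n → Tournament n → Set
Square a b c y = AdjS a b × AdjS b c × AdjD a y × AdjD y c × ¬ a ≈ c

square-resp : a ≈ a′ → b ≈ b′ → Square a b c y → Square a′ b′ c y
square-resp a≈a′ b≈b′ (ab , bc , ay , yc , a≉c) =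
  adjS-resp a≈a′ b≈b′ ab , adjS-resp b≈b′ ≈-refl bc , adjD-resp a≈a′ ≈-refl ay , yc , a≉c ∘ ≈-trans a≈a′

adjS-fixes-loop : AdjS T U → T (loop v) ≡ U (loop v)
adjS-fixes-loop (_ , t , _ , F) = sym (flip-∉ F (triangle-loop-free t))

adjS-adjD-exclusive : AdjS T U → AdjD T U → ⊥
adjS-adjD-exclusive S D with adjD-view D
... | _ , _ , P , _ , F = Bool.not-¬ refl (trans (adjS-fixes-loop S) (flip-∈ F (loop-∈-clover P)))

Touches : Tournament n → Tournament n → Fin n → Fin n → Set
Touches T U p q = ∃[ e ] (T e ≢ U e × Joins e p q)

adjS-support : AdjS T U → ∃[ a ] ∃[ b ] ∃[ c ]
  (∀ {p q} → Touches T U p q → p ∈ a ∷ b ∷ c ∷ [] × q ∈ a ∷ b ∷ c ∷ [])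
adjS-support (_ , t , _ , F) with triangle-support t
... | a , b , c , support = a , b , c , λ (_ , changed , j) → support (flip-changed F changed) j

-- Otherwise the triangle flip b → c would change both edges of the pair {p,q}.
touches-before-triangle : AdjS b c → JoinsNeg eN p q → JoinsPos eP p q →
  c eN ≡ not (a eN) → c eP ≡ not (a eP) → Touches a b p q
touches-before-triangle {b = b} {c = c} {eN = eN} {eP = eP} {a = a} (_ , t , _ , F) N P cN cP
  with a eN Bool.≟ b eN | a eP Bool.≟ b eP
... | no aN≢bN | _        = eN , aN≢bN , inj₁ N
... | yes _    | no aP≢bP = eP , aP≢bP , inj₂ P
... | yes aN≡bN | yes aP≡bP =
  ⊥-elim (triangle-pair-free t (flip-changed F (changed aN≡bN cN)) (flip-changed F (changed aP≡bP cP)) N P)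
  where
  changed : ∀ {e} → a e ≡ b e → c e ≡ not (a e) → b e ≢ c e
  changed a≡b c≡ b≡c = Bool.not-¬ refl (trans a≡b (trans b≡c c≡))

-- p is the loop vertex shared by the clovers a → y and y → c, and q, q′ are their other vertices.
record SquareShape {n} (a b c y : Tournament n) (p q q′ : Fin n) : Set where
  field
    q≢q′ : q ≢ q′
    first : EdgePair p q
    second : EdgePair p q′
    a→y : IsFlip a (clover first) y
    y→c : IsFlip y (clover second) c
    touches-q : Touches a b p q
    touches-q′ : Touches a b p q′
    agrees-q : contrib a (negE first) p ≡ contrib a (posE first) p
    agrees-q′ : contrib a (negE second) p ≡ contrib a (posE second) p
    loop-opposes-q : sgn (a (loop p)) ≡ - contrib a (negE first) p
    loop-follows-q′ : sgn (a (loop p)) ≡ contrib a (negE second) p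
open SquareShape

clovers-share-apex : (P : EdgePair p q) (P′ : EdgePair p′ q′) → AdjS a b → AdjS b c →
  IsFlip a (clover P) y → IsFlip y (clover P′) c → p ≡ p′
clovers-share-apex {p = p} {p′ = p′} {a = a} {b = b} {c = c} {y = y} P P′ ab bc F F′ with p ≟ p′
... | yes p≡p′ = p≡p′
... | no p≢p′ = ⊥-elim (Bool.not-¬ refl (begin
  a (loop p)       ≡⟨ adjS-fixes-loop ab ⟩
  b (loop p)       ≡⟨ adjS-fixes-loop bc ⟩
  c (loop p)       ≡⟨ flip-∉ F′ (loop-∉-clover p≢p′ P′) ⟩
  y (loop p)       ≡⟨ flip-∈ F (loop-∈-clover P) ⟩
  not (a (loop p)) ∎))
  where open ≡-Reasoning

second-clover-signs : (P : EdgePair p q) → IsFlip a (clover P) y → q ≢ q′ →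
  (P′ : EdgePair p q′) → Neutral y (clover P′) →
  contrib a (negE P′) p ≡ contrib a (posE P′) p × sgn (a (loop p)) ≡ contrib a (negE P′) p
second-clover-signs {p = p} {a = a} {y = y} P F q≢q′ P′ neutral with clover-neutral {T = y} P′ neutral
... | agrees , opposes =
  (begin
    contrib a (negE P′) p ≡⟨ sym (same-contrib yN≡aN) ⟩
    contrib y (negE P′) p ≡⟨ agrees ⟩
    contrib y (posE P′) p ≡⟨ same-contrib yP≡aP ⟩
    contrib a (posE P′) p ∎) ,
  ℤ.neg-injective (begin
    - sgn (a (loop p))      ≡⟨ sym (sgn-not (a (loop p))) ⟩
    sgn (not (a (loop p)))  ≡⟨ cong sgn (sym (flip-∈ F (loop-∈-clover P))) ⟩
    sgn (y (loop p))        ≡⟨ opposes ⟩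
    - contrib y (negE P′) p ≡⟨ cong -_ (same-contrib yN≡aN) ⟩
    - contrib a (negE P′) p ∎)
  where
  open ≡-Reasoning
  same-contrib : ∀ {e} → y e ≡ a e → contrib y e p ≡ contrib a e p
  same-contrib {e} = cong (λ o → sgn o * vec e p)
  yN≡aN : y (negE P′) ≡ a (negE P′)
  yN≡aN = flip-∉ F (joins-∉-clover (q≢q′ ∘ sym) (inj₁ (negJ P′)) P)
  yP≡aP : y (posE P′) ≡ a (posE P′)
  yP≡aP = flip-∉ F (joins-∉-clover (q≢q′ ∘ sym) (inj₂ (posJ P′)) P)

square-shape : Square a b c y → ∃[ p ] ∃[ q ] ∃[ q′ ] SquareShape a b c y p q q′
square-shape {a = a} {c = c} {y = y} (ab , bc , ay , yc , a≉c) with adjD-view ay | adjD-view yc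
... | p , q , P , neutral , F | _ , q′ , P′ , neutral′ , F′ with clovers-share-apex P P′ ab bc F F′
... | refl with q ≟ q′
... | yes refl = ⊥-elim (a≉c (flip-involutive F (subst (λ G → IsFlip y G c) (clover-unique P′ P) F′)))
... | no q≢q′ = p , q , q′ , record
  { q≢q′ = q≢q′ ; first = P ; second = P′ ; a→y = F ; y→c = F′
  ; touches-q  = touches-before-triangle bc (negJ P) (posJ P)
                   (flipped-first (here refl) (inj₁ (negJ P))) (flipped-first (there (here refl)) (inj₂ (posJ P)))
  ; touches-q′ = touches-before-triangle bc (negJ P′) (posJ P′)
                   (flipped-second (here refl) (inj₁ (negJ P′))) (flipped-second (there (here refl)) (inj₂ (posJ P′)))
  ; agrees-q = proj₁ (clover-neutral {T = a} P neutral) ; loop-opposes-q = proj₂ (clover-neutral {T = a} P neutral)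
  ; agrees-q′ = proj₁ (second-clover-signs P F q≢q′ P′ neutral′)
  ; loop-follows-q′ = proj₂ (second-clover-signs P F q≢q′ P′ neutral′)
  }
  where
  flipped-first : ∀ {e} → e ∈ clover P → Joins e p q → c e ≡ not (a e)
  flipped-first e∈P j = trans (flip-∉ F′ (joins-∉-clover q≢q′ j P′)) (flip-∈ F e∈P)
  flipped-second : ∀ {e} → e ∈ clover P′ → Joins e p q′ → c e ≡ not (a e)
  flipped-second e∈P′ j = trans (flip-∈ F′ e∈P′) (cong not (flip-∉ F (joins-∉-clover (q≢q′ ∘ sym) j P)))

-- Rigidity of squares

private
  fin3-exhausted : (i j k l : Fin 3) → j ≢ k → k ≢ l → j ≢ l → i ≢ j → i ≡ k ⊎ i ≡ l
  fin3-exhausted = toWitness {a? = Fin.all? λ i → Fin.all? λ j → Fin.all? λ k → Fin.all? λ l →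
    ¬? (j ≟ k) →-dec ¬? (k ≟ l) →-dec ¬? (j ≟ l) →-dec ¬? (i ≟ j) →-dec (i ≟ k ⊎-dec i ≟ l)} _

index-injective : {V : List (Fin n)} (u∈V : u ∈ V) (v∈V : v ∈ V) → Any.index u∈V ≡ Any.index v∈V → u ≡ v
index-injective {V = V} u∈V v∈V eq =
  trans (lookup-index u∈V) (trans (cong (lookup V) eq) (sym (lookup-index v∈V)))

distinct-triple-exhausts : {a b c u₁ u₂ u₃ : Fin n} → let V = a ∷ b ∷ c ∷ [] in
  w ∈ V → u₁ ∈ V → u₂ ∈ V → u₃ ∈ V → Distinct3 u₁ u₂ u₃ → w ≢ u₁ → w ≡ u₂ ⊎ w ≡ u₃
distinct-triple-exhausts w∈ u₁∈ u₂∈ u₃∈ (u₁≢u₂ , u₂≢u₃ , u₁≢u₃) w≢u₁ =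
  Sum.map (index-injective w∈ u₂∈) (index-injective w∈ u₃∈)
    (fin3-exhausted (Any.index w∈) (Any.index u₁∈) (Any.index u₂∈) (Any.index u₃∈)
      (u₁≢u₂ ∘ index-injective u₁∈ u₂∈) (u₂≢u₃ ∘ index-injective u₂∈ u₃∈)
      (u₁≢u₃ ∘ index-injective u₁∈ u₃∈) (w≢u₁ ∘ index-injective w∈ u₁∈))

arm-agrees : SquareShape a b c y p q q′ → w ≡ q ⊎ w ≡ q′ → Agrees a p w
arm-agrees S (inj₁ refl) = first S , agrees-q S
arm-agrees S (inj₂ refl) = second S , agrees-q′ S

same-vertices⇒same-square : SquareShape a b c y p q q′ → SquareShape a b c′ y′ r s s′ →
  p ≡ r → q ≡ s → q′ ≡ s′ → c ≈ c′ × y ≈ y′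
same-vertices⇒same-square {y = y} {y′ = y′} S S′ refl refl refl =
  flip-unique (clover-unique (second S) (second S′)) y≈y′ (y→c S) (y→c S′) , y≈y′
  where
  y≈y′ : y ≈ y′
  y≈y′ = flip-unique (clover-unique (first S) (first S′)) ≈-refl (a→y S) (a→y S′)

module SquareRigidity {n} {a b : Tournament n} {A B C : Fin n}
  (support : ∀ {u v} → Touches a b u v → u ∈ A ∷ B ∷ C ∷ [] × v ∈ A ∷ B ∷ C ∷ []) where

  non-apex⇒arm : SquareShape a b c y p q q′ → w ∈ A ∷ B ∷ C ∷ [] → w ≢ p → w ≡ q ⊎ w ≡ q′
  non-apex⇒arm S w∈ w≢p = distinct-triple-exhausts w∈
    (proj₁ (support (touches-q S))) (proj₂ (support (touches-q S))) (proj₂ (support (touches-q′ S)))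
    (joinsNeg-≢ (negJ (first S)) , q≢q′ S , joinsNeg-≢ (negJ (second S))) w≢p

  apex-unique : SquareShape a b c y p q q′ → SquareShape a b c′ y′ r s s′ → p ≡ r
  apex-unique {p = p} {r = r} S S′ with p ≟ r
  ... | yes p≡r = p≡r
  ... | no p≢r = ⊥-elim (agrees-asym {T = a}
    (arm-agrees S (non-apex⇒arm S (proj₁ (support (touches-q S′))) (p≢r ∘ sym)))
    (arm-agrees S′ (non-apex⇒arm S′ (proj₁ (support (touches-q S))) p≢r)))

  -- If s were q′, the loop at p would both oppose and follow the negative edge on {p,q′}.
  near-unique : SquareShape a b c y p q q′ → SquareShape a b c′ y′ r s s′ → p ≡ r → q ≡ s
  near-unique {p = p} S S′ refl with non-apex⇒arm S (proj₂ (support (touches-q S′))) (joinsNeg-≢ (negJ (first S′)) ∘ sym)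
  ... | inj₁ s≡q = sym s≡q
  ... | inj₂ refl = ⊥-elim (contrib-joinsNeg-≢-neg {T = a} (negJ (second S)) (begin
    contrib a (negE (second S)) p  ≡⟨ sym (loop-follows-q′ S) ⟩
    sgn (a (loop p))               ≡⟨ loop-opposes-q S′ ⟩
    - contrib a (negE (first S′)) p ≡⟨ cong (λ e → - contrib a e p) (joinsNeg-unique (negJ (first S′)) (negJ (second S))) ⟩
    - contrib a (negE (second S)) p ∎))
    where open ≡-Reasoning

  far-unique : SquareShape a b c y p q q′ → SquareShape a b c′ y′ r s s′ → p ≡ r → q ≡ s → q′ ≡ s′
  far-unique S S′ refl refl with non-apex⇒arm S (proj₂ (support (touches-q′ S′))) (joinsNeg-≢ (negJ (second S′)) ∘ sym)
  ... | inj₁ s′≡q = ⊥-elim (q≢q′ S′ (sym s′≡q))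
  ... | inj₂ s′≡q′ = sym s′≡q′

  shapes-coincide : SquareShape a b c y p q q′ → SquareShape a b c′ y′ r s s′ → c ≈ c′ × y ≈ y′
  shapes-coincide {p = p} {q = q} {r = r} {s = s} S S′ = same-vertices⇒same-square S S′ p≡r q≡s (far-unique S S′ p≡r q≡s)
    where
    p≡r : p ≡ r
    p≡r = apex-unique S S′
    q≡s : q ≡ s
    q≡s = near-unique S S′ p≡r

square-unique : Square a b c y → Square a b c′ y′ → c ≈ c′ × y ≈ y′
square-unique sq sq′ =
  let (_ , _ , _ , S) = square-shape sq
      (_ , _ , _ , S′) = square-shape sq′
      (_ , _ , _ , support) = adjS-support (proj₁ sq)
  in SquareRigidity.shapes-coincide support S S′

-- Crystals

multIs-adj : MultIs T U m → Adj T U → m ≢ 0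
multIs-adj (inj₁ (_ , ¬adj)) adj = ⊥-elim (¬adj adj)
multIs-adj (inj₂ (inj₁ (refl , _))) _ = λ ()
multIs-adj (inj₂ (inj₂ (refl , _))) _ = λ ()

multIs-single : MultIs T U m → m ≡ 1 → AdjS T U
multIs-single (inj₁ (refl , _)) ()
multIs-single (inj₂ (inj₁ (_ , S))) _ = S
multIs-single (inj₂ (inj₂ (refl , _))) ()

multIs-double : MultIs T U m → m ≡ 2 → AdjD T U
multIs-double (inj₁ (refl , _)) ()
multIs-double (inj₂ (inj₁ (refl , _))) ()
multIs-double (inj₂ (inj₂ (_ , D))) _ = D

multIs-adjS : MultIs T U m → AdjS T U → m ≡ 1
multIs-adjS (inj₁ (_ , ¬adj)) S = ⊥-elim (¬adj (inj₁ S))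
multIs-adjS (inj₂ (inj₁ (m≡1 , _))) _ = m≡1
multIs-adjS (inj₂ (inj₂ (_ , D))) S = ⊥-elim (adjS-adjD-exclusive S D)

nhatMult-edge : NhatMult T₁ T₂ T U m → m ≢ 0 → EdgeNhat T₁ T₂ T U
nhatMult-edge (inj₁ (E , _)) _ = E
nhatMult-edge (inj₂ (_ , m≡0)) m≢0 = ⊥-elim (m≢0 m≡0)

nhatMult-multIs : NhatMult T₁ T₂ T U m → EdgeNhat T₁ T₂ T U → MultIs T U m
nhatMult-multIs (inj₁ (_ , M)) _ = M
nhatMult-multIs (inj₂ (¬E , _)) E = ⊥-elim (¬E E)

-- IsCrystal T₁ T₂ unfolds to Dist2 T₁ T₂ × Σ φ (IsLabelling T₁ T₂ φ).
IsLabelling : Tournament n → Tournament n → (Fin 6 → Tournament n) → Set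
IsLabelling T₁ T₂ φ =
    (∀ k l → φ k ≈ φ l → k ≡ l)
  × (∀ k → InNhat T₁ T₂ (φ k))
  × (∀ X → InNhat T₁ T₂ X → ∃[ k ] (X ≈ φ k))
  × (∀ k l → NhatMult T₁ T₂ (φ k) (φ l) (crystalMult k l))

module Labelling {n} {T₁ T₂ : Tournament n} {φ : Fin 6 → Tournament n} (L : IsLabelling T₁ T₂ φ) where

  injective : ∀ k l → φ k ≈ φ l → k ≡ l
  injective = proj₁ L

  labelled : ∀ k → InNhat T₁ T₂ (φ k)
  labelled = proj₁ (proj₂ L)

  covers : ∀ X → InNhat T₁ T₂ X → ∃[ k ] (X ≈ φ k)
  covers = proj₁ (proj₂ (proj₂ L))

  multiplicity : ∀ k l → NhatMult T₁ T₂ (φ k) (φ l) (crystalMult k l)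
  multiplicity = proj₂ (proj₂ (proj₂ L))

  edge⇒mult≢0 : ∀ {k l} → EdgeNhat T₁ T₂ (φ k) (φ l) → crystalMult k l ≢ 0
  edge⇒mult≢0 {k} {l} E = multIs-adj (nhatMult-multIs (multiplicity k l) E) (edgeNhat-adj E)

  mult≢0⇒edge : ∀ {k l} → crystalMult k l ≢ 0 → EdgeNhat T₁ T₂ (φ k) (φ l)
  mult≢0⇒edge {k} {l} = nhatMult-edge (multiplicity k l)

  mult≢0⇒multIs : ∀ {k l} → crystalMult k l ≢ 0 → MultIs (φ k) (φ l) (crystalMult k l)
  mult≢0⇒multIs {k} {l} m≢0 = nhatMult-multIs (multiplicity k l) (mult≢0⇒edge m≢0)

  mult≡1⇒adjS : ∀ {k l} → crystalMult k l ≡ 1 → AdjS (φ k) (φ l)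
  mult≡1⇒adjS m≡1 = multIs-single (mult≢0⇒multIs (ℕ.1+n≢0 ∘ trans (sym m≡1))) m≡1

  mult≡2⇒adjD : ∀ {k l} → crystalMult k l ≡ 2 → AdjD (φ k) (φ l)
  mult≡2⇒adjD m≡2 = multIs-double (mult≢0⇒multIs (ℕ.1+n≢0 ∘ trans (sym m≡2))) m≡2

  adjS⇒mult≡1 : ∀ {k l} → EdgeNhat T₁ T₂ (φ k) (φ l) → AdjS (φ k) (φ l) → crystalMult k l ≡ 1
  adjS⇒mult≡1 {k} {l} E = multIs-adjS (nhatMult-multIs (multiplicity k l) E)

  locate : EdgeNhat T₁ T₂ T U → ∃[ k ] ∃[ l ] (T ≈ φ k × U ≈ φ l × EdgeNhat T₁ T₂ (φ k) (φ l))
  locate E with covers _ (proj₁ (edgeNhat-inNhat E)) | covers _ (proj₂ (edgeNhat-inNhat E))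
  ... | k , T≈φk | l , U≈φl = k , l , T≈φk , U≈φl , edgeNhat-resp T≈φk U≈φl E

  square : (i j k l : Fin 6) → crystalMult i j ≡ 1 → crystalMult j k ≡ 1 →
    crystalMult i l ≡ 2 → crystalMult l k ≡ 2 → i ≢ k → Square (φ i) (φ j) (φ k) (φ l)
  square i _ k _ ij jk il lk i≢k =
    mult≡1⇒adjS ij , mult≡1⇒adjS jk , mult≡2⇒adjD il , mult≡2⇒adjD lk , i≢k ∘ injective i k

  square-abc : Square (φ 0F) (φ 1F) (φ 2F) (φ 4F)
  square-abc = square 0F 1F 2F 4F refl refl refl refl λ ()

  square-bcd : Square (φ 1F) (φ 2F) (φ 3F) (φ 5F)
  square-bcd = square 1F 2F 3F 5F refl refl refl refl λ ()

labellings-agree : IsLabelling T₁ T₂ φ → IsLabelling U₁ U₂ ψ →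
  φ 0F ≈ ψ 0F → φ 1F ≈ ψ 1F → ∀ k → φ k ≈ ψ k
labellings-agree {φ = φ} {ψ = ψ} L M a≈ b≈ = λ where
    0F → a≈
    1F → b≈
    2F → proj₁ cy≈
    3F → proj₁ dz≈
    4F → proj₂ cy≈
    5F → proj₂ dz≈
  where
  cy≈ : φ 2F ≈ ψ 2F × φ 4F ≈ ψ 4F
  cy≈ = square-unique (Labelling.square-abc L) (square-resp (≈-sym a≈) (≈-sym b≈) (Labelling.square-abc M))
  dz≈ : φ 3F ≈ ψ 3F × φ 5F ≈ ψ 5F
  dz≈ = square-unique (Labelling.square-bcd L) (square-resp (≈-sym b≈) (≈-sym (proj₁ cy≈)) (Labelling.square-bcd M))

labellings-⊆ : IsLabelling T₁ T₂ φ → IsLabelling U₁ U₂ ψ → (∀ k → φ k ≈ ψ k) →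
  (∀ X → InNhat T₁ T₂ X → InNhat U₁ U₂ X) × (∀ X Y → EdgeNhat T₁ T₂ X Y → EdgeNhat U₁ U₂ X Y)
labellings-⊆ {T₁ = T₁} {T₂ = T₂} {U₁ = U₁} {U₂ = U₂} L M φ≈ψ = vertices , edges
  where
  vertices : ∀ X → InNhat T₁ T₂ X → InNhat U₁ U₂ X
  vertices X X∈ with Labelling.covers L X X∈
  ... | k , X≈φk = inNhat-resp (≈-sym (≈-trans X≈φk (φ≈ψ k))) (Labelling.labelled M k)
  edges : ∀ X Y → EdgeNhat T₁ T₂ X Y → EdgeNhat U₁ U₂ X Y
  edges X Y E with Labelling.locate L E
  ... | k , l , X≈φk , Y≈φl , E′ = edgeNhat-resp (≈-sym (≈-trans X≈φk (φ≈ψ k))) (≈-sym (≈-trans Y≈φl (φ≈ψ l)))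
    (Labelling.mult≢0⇒edge M (Labelling.edge⇒mult≢0 L E′))

labellings-sameNhat : IsLabelling T₁ T₂ φ → IsLabelling U₁ U₂ ψ → (∀ k → φ k ≈ ψ k) → SameNhat T₁ T₂ U₁ U₂
labellings-sameNhat L M φ≈ψ =
  let (V⊆ , E⊆) = labellings-⊆ L M φ≈ψ
      (V⊇ , E⊇) = labellings-⊆ M L (≈-sym ∘ φ≈ψ)
  in (λ X → V⊆ X , V⊇ X) , (λ X Y → E⊆ X Y , E⊇ X Y)

IsAutomorphism : (Fin 6 → Fin 6) → Set
IsAutomorphism σ = (∀ i j → crystalMult (σ i) (σ j) ≡ crystalMult i j)
                 × (∀ i j → σ i ≡ σ j → i ≡ j)
                 × (∀ k → ∃[ i ] σ i ≡ k)

automorphism? : ∀ σ → Dec (IsAutomorphism σ)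
automorphism? σ = Fin.all? (λ i → Fin.all? λ j → crystalMult (σ i) (σ j) ℕ.≟ crystalMult i j)
            ×-dec Fin.all? (λ i → Fin.all? λ j → σ i ≟ σ j →-dec i ≟ j)
            ×-dec Fin.all? (λ k → Fin.any? λ i → σ i ≟ k)

relabel : IsLabelling T₁ T₂ φ → IsAutomorphism σ → IsLabelling T₁ T₂ (φ ∘ σ)
relabel {T₁ = T₁} {T₂} {φ} {σ} (injective , labelled , covers , multiplicity) (preserves , σ-injective , σ-surjective) =
  (λ i j → σ-injective i j ∘ injective (σ i) (σ j)) , labelled ∘ σ , covers′ ,
  λ i j → subst (NhatMult T₁ T₂ (φ (σ i)) (φ (σ j))) (preserves i j) (multiplicity (σ i) (σ j))
  where
  covers′ : ∀ X → InNhat T₁ T₂ X → ∃[ i ] (X ≈ φ (σ i))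
  covers′ X X∈ with covers X X∈
  ... | k , X≈φk with σ-surjective k
  ... | i , refl = i , X≈φk

model-map : Fin 6 → Fin 6 → Fin 6 → Fin 6 → Fin 6 → Fin 6 → Fin 6 → Fin 6
model-map a _ _ _ _ _ 0F = a
model-map _ b _ _ _ _ 1F = b
model-map _ _ c _ _ _ 2F = c
model-map _ _ _ d _ _ 3F = d
model-map _ _ _ _ y _ 4F = y
model-map _ _ _ _ _ z 5F = z

square-symmetries : List (Fin 6 → Fin 6)
square-symmetries =
    model-map 0F 1F 2F 3F 4F 5F ∷ model-map 1F 2F 3F 0F 5F 4F
  ∷ model-map 2F 3F 0F 1F 4F 5F ∷ model-map 3F 0F 1F 2F 5F 4F
  ∷ model-map 0F 3F 2F 1F 4F 5F ∷ model-map 1F 0F 3F 2F 5F 4F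
  ∷ model-map 2F 1F 0F 3F 4F 5F ∷ model-map 3F 2F 1F 0F 5F 4F ∷ []

-- Opaque, so that the type checker never unfolds the decision procedure.
opaque
  single-edges-transitive : ∀ k l → crystalMult k l ≡ 1 → ∃[ σ ] (IsAutomorphism σ × σ 0F ≡ k × σ 1F ≡ l)
  single-edges-transitive k l m≡1 = Any.satisfied (toWitness {a? = Fin.all? λ k → Fin.all? λ l →
    crystalMult k l ℕ.≟ 1 →-dec Any.any? (λ σ → automorphism? σ ×-dec σ 0F ≟ k ×-dec σ 1F ≟ l) square-symmetries} _ k l m≡1)

single-edge-relabel : IsLabelling T₁ T₂ φ → EdgeNhat T₁ T₂ T U → AdjS T U →
  ∃[ φ′ ] (IsLabelling T₁ T₂ φ′ × T ≈ φ′ 0F × U ≈ φ′ 1F)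
single-edge-relabel L E S with Labelling.locate L E
... | k , l , T≈φk , U≈φl , E′ with single-edges-transitive k l (Labelling.adjS⇒mult≡1 L E′ (adjS-resp T≈φk U≈φl S))
... | _ , σ-aut , refl , refl = _ , relabel L σ-aut , T≈φk , U≈φl

no-shared-single-edge : IsCrystal T₁ T₂ → IsCrystal U₁ U₂ → ¬ SameNhat T₁ T₂ U₁ U₂ →
  ¬ (∃[ X ] ∃[ Y ] (EdgeNhat T₁ T₂ X Y × EdgeNhat U₁ U₂ X Y × AdjS X Y))
no-shared-single-edge (_ , _ , L) (_ , _ , M) different (_ , _ , E , E′ , S)
  with single-edge-relabel L E S | single-edge-relabel M E′ S
... | _ , L′ , X≈φa , Y≈φb | _ , M′ , X≈ψa , Y≈ψb = different (labellings-sameNhat L′ M′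
  (labellings-agree L′ M′ (≈-trans (≈-sym X≈φa) X≈ψa) (≈-trans (≈-sym Y≈φb) Y≈ψb)))

all-edges? : {P : Edge n → Set} → (∀ e → Dec (P e)) → Dec (∀ e → P e)
all-edges? P? = map′
  (λ h → λ { (neg i j) → proj₁ (h i) j ; (pos i j) → proj₁ (proj₂ (h i)) j ; (loop i) → proj₂ (proj₂ (h i)) })
  (λ h i → (λ j → h (neg i j)) , (λ j → h (pos i j)) , h (loop i))
  (Fin.all? λ i → Fin.all? (P? ∘ neg i) ×-dec Fin.all? (P? ∘ pos i) ×-dec P? (loop i))

_≈?_ : (T U : Tournament n) → Dec (T ≈ U)
T ≈? U = all-edges? λ e → T e Bool.≟ U e

SharedModelEdge : (Fin 6 → Tournament n) → (Fin 6 → Tournament n) → Set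
SharedModelEdge φ ψ = ∃[ k ] ∃[ l ] ∃[ k′ ] ∃[ l′ ]
  (crystalMult k l ≢ 0 × crystalMult k′ l′ ≢ 0 × φ k ≈ ψ k′ × φ l ≈ ψ l′)

sharedModelEdge? : (φ ψ : Fin 6 → Tournament n) → Dec (SharedModelEdge φ ψ)
sharedModelEdge? φ ψ = Fin.any? λ k → Fin.any? λ l → Fin.any? λ k′ → Fin.any? λ l′ →
  ¬? (crystalMult k l ℕ.≟ 0) ×-dec ¬? (crystalMult k′ l′ ℕ.≟ 0) ×-dec φ k ≈? ψ k′ ×-dec φ l ≈? ψ l′

disjoint-or-shared-double : IsCrystal T₁ T₂ → IsCrystal U₁ U₂ → ¬ SameNhat T₁ T₂ U₁ U₂ →
  (∀ X Y → EdgeNhat T₁ T₂ X Y → EdgeNhat U₁ U₂ X Y → ⊥)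
  ⊎ (∃[ X ] ∃[ Y ] (EdgeNhat T₁ T₂ X Y × EdgeNhat U₁ U₂ X Y × AdjD X Y))
disjoint-or-shared-double {T₁ = T₁} {T₂ = T₂} {U₁ = U₁} {U₂ = U₂} crT@(_ , φ , L) crU@(_ , ψ , M) different =
  decide (sharedModelEdge? φ ψ)
  where
  decide : Dec (SharedModelEdge φ ψ) → (∀ X Y → EdgeNhat T₁ T₂ X Y → EdgeNhat U₁ U₂ X Y → ⊥)
    ⊎ (∃[ X ] ∃[ Y ] (EdgeNhat T₁ T₂ X Y × EdgeNhat U₁ U₂ X Y × AdjD X Y))
  decide (yes (k , l , k′ , l′ , mkl≢0 , mk′l′≢0 , φk≈ψk′ , φl≈ψl′)) = inj₂ (_ , _ , E , E′ , double (edgeNhat-adj E))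
    where
    E : EdgeNhat T₁ T₂ (φ k) (φ l)
    E = Labelling.mult≢0⇒edge L mkl≢0
    E′ : EdgeNhat U₁ U₂ (φ k) (φ l)
    E′ = edgeNhat-resp (≈-sym φk≈ψk′) (≈-sym φl≈ψl′) (Labelling.mult≢0⇒edge M mk′l′≢0)
    double : Adj (φ k) (φ l) → AdjD (φ k) (φ l)
    double (inj₁ S) = ⊥-elim (no-shared-single-edge crT crU different (_ , _ , E , E′ , S))
    double (inj₂ D) = D
  decide (no unshared) = inj₁ λ X Y E E′ → unshared (shared E E′)
    where
    shared : ∀ {X Y} → EdgeNhat T₁ T₂ X Y → EdgeNhat U₁ U₂ X Y → SharedModelEdge φ ψ
    shared E E′ =
      let (k , l , X≈φk , Y≈φl , Eφ) = Labelling.locate L E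
          (k′ , l′ , X≈ψk′ , Y≈ψl′ , Eψ) = Labelling.locate M E′
      in k , l , k′ , l′ , Labelling.edge⇒mult≢0 L Eφ , Labelling.edge⇒mult≢0 M Eψ ,
         ≈-trans (≈-sym X≈φk) X≈ψk′ , ≈-trans (≈-sym Y≈φl) Y≈ψl′

lemma22 : (n : ℕ) (s : Fin n → ℤ) → InScore s →
    (T₁ T₂ U₁ U₂ : Tournament n) →
    Vtx s T₁ → Vtx s T₂ → Vtx s U₁ → Vtx s U₂ →
    IsCrystal T₁ T₂ → IsCrystal U₁ U₂ → ¬ SameNhat T₁ T₂ U₁ U₂ →
    ((∀ X Y → EdgeNhat T₁ T₂ X Y → EdgeNhat U₁ U₂ X Y → ⊥)
      ⊎ (∃[ X ] ∃[ Y ] (EdgeNhat T₁ T₂ X Y × EdgeNhat U₁ U₂ X Y × AdjD X Y)))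
    × ¬ (∃[ X ] ∃[ Y ] (EdgeNhat T₁ T₂ X Y × EdgeNhat U₁ U₂ X Y × AdjS X Y))
-- Adjacency does not depend on the score sequence.
lemma22 _ _ _ _ _ _ _ _ _ _ _ crT crU different =
  disjoint-or-shared-double crT crU different , no-shared-single-edge crT crU different
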